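{- Given $\rho>0$, integers $m\ge k\ge 3$ and $t\in[k]$, there exists $N\in\mathbb N$ such that the following holds. Let $\mathcal A$ be an $N$-reduced $k$-graph with index set $[N]$, and suppose that for each $\mathcal Y=\{y_1<\dots<y_k\}\in[N]^k$ there is a subset $\mathcal S_{\mathcal Y\setminus\{y_t\}\to y_t}\subseteq\mathcal P_{\mathcal Y\setminus\{y_t\}}$ with $|\mathcal S_{\mathcal Y\setminus\{y_t\}\to y_t}|\ge\rho|\mathcal P_{\mathcal Y\setminus\{y_t\}}|$. Then there exist a set $M\subseteq[N]$ with $|M|=m$ and vertices $v_{\mathcal X}\in\mathcal P_{\mathcal X}$ for all $\mathcal X\in[M]^{k-1}$ such that for each $\mathcal X=\{x_1<\dots<x_{k-1}\}\in[M]^{k-1}$, \[ v_{\mathcal X}\in\bigcap_{y\in M,\ x_{t-1}<y<x_t}\mathcal S_{\mathcal X\to y}, \] where $x_0=0$ and $x_k=N$.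
   Context: For a set $I$, $[I]^j$ denotes its $j$-element subsets. An $N$-reduced $k$-graph $\mathcal A$ with index set $[N]$ consists of pairwise disjoint finite nonempty vertex classes $\mathcal P_{\mathcal X}$, $\mathcal X\in[N]^{k-1}$, and for each $\mathcal Y\in[N]^k$ a $k$-partite $k$-graph $\mathcal A_{\mathcal Y}$ with vertex partition $\{\mathcal P_{\mathcal X}:\mathcal X\in[\mathcal Y]^{k-1}\}$. In the conclusion, for $y$ with $x_{t-1}<y<x_t$, $y$ is the $t$-th smallest element of $\mathcal Y=\mathcal X\cup\{y\}$ and $\mathcal S_{\mathcal X\to y}$ denotes the given set $\mathcal S_{\mathcal Y\setminus\{y_t\}\to y_t}$ for this $\mathcal Y$.
   Formalization: The parameter ρ ranges over the positive rationals. -}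

module Defs where

open import Data.Nat using (ℕ; _<_; _∸_)
open import Data.Fin using (Fin)
open import Data.Fin.Properties using (_<?_)
open import Data.Fin.Subset using (Subset; _⊆_; ∣_∣; _∩_)
open import Data.Vec using (tabulate)
open import Relation.Nullary using (does)
open import Relation.Binary.PropositionalEquality using (_≡_)

-- The index set [N] is modelled by Fin N; a subset of [N] by Subset N.
-- [N]^j = subsets X with ∣ X ∣ ≡ j.

below : {N : ℕ} → Fin N → Subset N
below y = tabulate (λ i → does (i <? y))

-- Number of elements of X smaller than y.
-- For y ∉ X, y is the t-th smallest element of X ∪ {y} iff countBelow X y ≡ t ∸ 1,
-- i.e. x_{t-1} < y < x_t.
countBelow : {N : ℕ} → Subset N → Fin N → ℕ
countBelow X y = ∣ X ∩ below y ∣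

-- The vertex class P_X (for X ∈ [N]^{k-1}) is Fin (size X); tagging vertices by X makes the
-- classes pairwise disjoint. Values of size on subsets not of size k-1 are irrelevant.
-- For Y ∈ [N]^k, edge Y is a predicate on the k-tuples choosing one vertex from each
-- P_X, X ∈ [Y]^{k-1} (a k-partite k-graph with that vertex partition).
record ReducedGraph (k N : ℕ) : Set₁ where
  field
    size     : Subset N → ℕ
    nonempty : (X : Subset N) → ∣ X ∣ ≡ k ∸ 1 → 0 < size X
    edge     : (Y : Subset N) → ∣ Y ∣ ≡ k →
               ((X : Subset N) → X ⊆ Y → ∣ X ∣ ≡ k ∸ 1 → Fin (size X)) → Set

-- Write ρ ≥ 1/D. Colour each m-subset Z of [N] by the first pattern θ (the relative position of a
-- (k-1)-set X inside Z) that is bad for Z: no vertex of P_X lies in S_{X→y} for every y ∈ Z in the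
-- t-th gap of X. Colour 0 means that no pattern is bad. Ramsey's theorem gives a set H of size
-- m + D·m on which the colour is constant. It cannot be a pattern θ: realise θ on H with D·ℓ
-- consecutive candidates of H in the t-th gap of X. Each S_{X→y} has density at least 1/D in P_X,
-- so averaging gives a vertex lying in ℓ of them, and keeping only those ℓ candidates yields an
-- m-subset of H on which θ is not bad. Hence the colour is 0, and any m-subset of H is the set M.
module Submission where

open import Defs
open import Data.Nat as ℕ using (ℕ; zero; suc; _+_; _∸_; _<_; _≤_; _<?_; _≟_; s≤s; NonZero; >-nonZero)
open import Data.Nat.Properties
open import Data.Bool using (Bool; true; false)
open import Data.Fin using (Fin; zero; suc) renaming (_<_ to _<ᶠ_)
import Data.Fin.Properties as Fin
open import Data.Fin.Subset using (Subset; _∈_; _∉_; _⊆_; ∣_∣; ⁅_⁆; _∪_; _∩_; ⊥; inside; outside)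
open import Data.Fin.Subset.Properties
  using ( _∈?_; x∈⁅x⁆; x∈⁅y⁆⇒x≡y; ∣⁅x⁆∣≡1; ∉⊥; ∣⊥∣≡0; ∪-identityˡ; x∈p∪q⁺; x∈p∪q⁻
        ; x∈p∩q⁺; x∈p∩q⁻; p⊂q⇒∣p∣<∣q∣; ⊆-antisym )
open import Data.Vec using ([]; _∷_; here; there; tail)
open import Data.Vec.Properties using (lookup∘tabulate; []=⇒lookup; lookup⇒[]=)
open import Data.List
  using (List; []; _∷_; [_]; _++_; length; map; filter; take; replicate; allFin; lookup; initLast; _∷ʳ′_)
open import Data.List.Properties using (length-++; length-map; length-take; length-replicate; length-tabulate)
open import Data.List.Relation.Unary.All as All using (All; []; _∷_)
open import Data.List.Relation.Unary.All.Properties using (all-filter)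
open import Data.List.Relation.Unary.Any as Any using (Any; here; there; index; any?)
open import Data.List.Relation.Unary.Any.Properties using (lookup-index)
open import Data.List.Relation.Unary.AllPairs as AllPairs using (AllPairs; []; _∷_)
open import Data.List.Relation.Unary.AllPairs.Properties using (tabulate⁺-<)
open import Data.List.Relation.Unary.Unique.Propositional using (Unique)
open import Data.List.Membership.Propositional using () renaming (_∈_ to _∈ₗ_; _∉_ to _∉ₗ_)
open import Data.List.Membership.Propositional.Properties
  using (∈-++⁺ˡ; ∈-++⁺ʳ; ∈-++⁻; ∈-map⁺; ∈-map⁻; ∈-filter⁺; ∈-filter⁻; ∈-lookup)
open import Data.List.Relation.Binary.Sublist.Propositional
  using ([]; _∷_; _∷ʳ_; ⊆-refl; ⊆-trans) renaming (_⊆_ to _⊑_)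
open import Data.List.Relation.Binary.Sublist.Propositional.Properties
  using ([]⊆-universal; take-⊆; filter-⊆; map⁺; ++⁺; ++⁺ˡ; ++⁺ʳ; All-resp-⊆; Any-resp-⊆)
open import Data.Product using (Σ; ∃; ∃-syntax; _×_; _,_; proj₁; proj₂)
open import Data.Sum using (_⊎_; inj₁; inj₂)
open import Data.Empty using (⊥-elim)
open import Function using (id; _∘_)
open import Relation.Nullary using (¬_; Dec; yes; no; does; contradiction)
open import Relation.Nullary.Decidable using (¬?; _→-dec_; _×-dec_; decidable-stable; dec-true)
open import Relation.Unary using (Decidable)
open import Relation.Binary.PropositionalEquality
  using (_≡_; _≢_; refl; sym; trans; cong; cong₂; subst; subst₂; module ≡-Reasoning)
import Algebra.Properties.CommutativeSemigroup as CommSemigroupProperties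
open CommSemigroupProperties +-commutativeSemigroup using () renaming (x∙yz≈y∙xz to +-leftComm)
open CommSemigroupProperties *-commutativeSemigroup using () renaming (x∙yz≈y∙xz to *-leftComm)


module Counting where

  -- The statement needs ℚ's _*_ at top level, so ℕ's _*_ is opened only inside these modules.
  open import Data.Nat using (_*_)

  sublist-of-length : ∀ {A : Set} {h} (xs : List A) → h ≤ length xs → ∃[ ys ] ys ⊑ xs × length ys ≡ h
  sublist-of-length {h = h} xs h≤xs = take h xs , take-⊆ h xs , trans (length-take h xs) (m≤n⇒m⊓n≡m h≤xs)

  split-at : ∀ {A : Set} a {r} (xs : List A) → a + r ≤ length xs →
    ∃[ ys ] ∃[ zs ] xs ≡ ys ++ zs × length ys ≡ a × r ≤ length zs
  split-at zero    xs       r≤xs       = [] , xs , refl , refl , r≤xs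
  split-at (suc a) (x ∷ xs) (s≤s a+r≤) with split-at a xs a+r≤
  ... | ys , zs , refl , refl , r≤zs = x ∷ ys , zs , refl , refl , r≤zs

  weight : ∀ {A : Set} {n} → (A → Subset n) → List A → ℕ
  weight T []      = 0
  weight T (y ∷ B) = ∣ T y ∣ + weight T B

  weight-of-empty : ∀ {A : Set} (T : A → Subset 0) B → weight T B ≡ 0
  weight-of-empty T []      = refl
  weight-of-empty T (y ∷ B) with T y
  ... | [] = weight-of-empty T B

  weight-split : ∀ {A : Set} {n} (T : A → Subset (suc n)) B →
    weight T B ≡ length (filter (λ y → zero ∈? T y) B) + weight (tail ∘ T) B
  weight-split T []      = refl
  weight-split T (y ∷ B) with T y | weight-split T B
  ... | inside  ∷ p | split = cong suc (trans (cong (∣ p ∣ +_) split) (+-leftComm ∣ p ∣ _ (weight (tail ∘ T) B)))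
  ... | outside ∷ p | split = trans (cong (∣ p ∣ +_) split) (+-leftComm ∣ p ∣ _ (weight (tail ∘ T) B))

  ∈-tail : ∀ {n} {v : Fin n} (p : Subset (suc n)) → v ∈ tail p → suc v ∈ p
  ∈-tail (_ ∷ p) v∈p = there v∈p

  -- Either vertex 0 lies in more than ℓ of the sets, or removing it costs the weight at most ℓ.
  popular-element : ∀ {A : Set} {n} ℓ (T : A → Subset n) (B : List A) → n * ℓ < weight T B →
    ∃[ v ] ∃[ L ] L ⊑ B × ℓ < length L × All (λ y → v ∈ T y) L
  popular-element {n = zero} ℓ T B 0<w = contradiction (weight-of-empty T B) (m<n⇒n≢0 0<w)
  popular-element {n = suc n} ℓ T B ℓ+nℓ<w with ℓ <? length (filter (λ y → zero ∈? T y) B)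
  ... | yes ℓ<B₀ = zero , _ , filter-⊆ (λ y → zero ∈? T y) B , ℓ<B₀ , all-filter (λ y → zero ∈? T y) B
  ... | no ℓ≮B₀ with popular-element ℓ (tail ∘ T) B nℓ<w′
    where
    nℓ<w′ : n * ℓ < weight (tail ∘ T) B
    nℓ<w′ = +-cancelˡ-< ℓ (n * ℓ) (weight (tail ∘ T) B) (begin-strict
      ℓ + n * ℓ                                                   <⟨ ℓ+nℓ<w ⟩
      weight T B                                                  ≡⟨ weight-split T B ⟩
      length (filter (λ y → zero ∈? T y) B) + weight (tail ∘ T) B ≤⟨ +-monoˡ-≤ _ (≮⇒≥ ℓ≮B₀) ⟩
      ℓ + weight (tail ∘ T) B                                     ∎)
      where open ≤-Reasoning
  ... | v , L , L⊑B , ℓ<L , v∈TL = suc v , L , L⊑B , ℓ<L , All.map (∈-tail _) v∈TL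

  pigeonhole : ∀ {A : Set} {c} h (f : A → Fin c) (B : List A) → c * h < length B →
    ∃[ col ] ∃[ L ] L ⊑ B × h < length L × All (λ y → f y ≡ col) L
  pigeonhole h f B ch<B with popular-element h (⁅_⁆ ∘ f) B (subst (_ <_) (sym (weight-singletons B)) ch<B)
    where
    weight-singletons : ∀ B → weight (⁅_⁆ ∘ f) B ≡ length B
    weight-singletons []      = refl
    weight-singletons (y ∷ B) = cong₂ _+_ (∣⁅x⁆∣≡1 (f y)) (weight-singletons B)
  ... | col , L , L⊑B , h<L , col∈fL = col , L , L⊑B , h<L , All.map (sym ∘ x∈⁅y⁆⇒x≡y _) col∈fL

  weight-lower : ∀ {A : Set} {n} D (T : A → Subset n) B → All (λ y → n ≤ D * ∣ T y ∣) B →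
    n * length B ≤ D * weight T B
  weight-lower {n = n} D T []      []              = ≤-reflexive (trans (*-zeroʳ n) (sym (*-zeroʳ D)))
  weight-lower {n = n} D T (y ∷ B) (n≤DTy ∷ dense) = begin
    n * suc (length B)            ≡⟨ *-suc n (length B) ⟩
    n + n * length B              ≤⟨ +-mono-≤ n≤DTy (weight-lower D T B dense) ⟩
    D * ∣ T y ∣ + D * weight T B  ≡⟨ *-distribˡ-+ D ∣ T y ∣ (weight T B) ⟨
    D * (∣ T y ∣ + weight T B)    ∎
    where open ≤-Reasoning

  common-element : ∀ {A : Set} {n} D .{{_ : NonZero D}} ℓ (T : A → Subset n) (B : List A) → 0 < n →
    All (λ y → n ≤ D * ∣ T y ∣) B → D * ℓ ≤ length B →
    ∃[ v ] ∃[ L ] L ⊑ B × length L ≡ ℓ × All (λ y → v ∈ T y) L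
  common-element {n = suc _} D zero T B _ _ _ = zero , [] , []⊆-universal B , refl , []
  common-element {n = n} D (suc ℓ) T B 0<n dense Dℓ≤B with popular-element ℓ T B nℓ<w
    where
    instance
      n≢0 : NonZero n
      n≢0 = >-nonZero 0<n
    nℓ<w : n * ℓ < weight T B
    nℓ<w = *-cancelˡ-< D (n * ℓ) (weight T B) (begin-strict
      D * (n * ℓ)      <⟨ *-monoʳ-< D (*-monoʳ-< n (n<1+n ℓ)) ⟩
      D * (n * suc ℓ)  ≡⟨ *-leftComm D n (suc ℓ) ⟩
      n * (D * suc ℓ)  ≤⟨ *-monoʳ-≤ n Dℓ≤B ⟩
      n * length B     ≤⟨ weight-lower D T B dense ⟩
      D * weight T B   ∎)
      where open ≤-Reasoning
  ... | v , L , L⊑B , ℓ<L , v∈TL with sublist-of-length L ℓ<L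
  ... | L′ , L′⊑L , |L′| = v , L′ , ⊆-trans L′⊑L L⊑B , |L′| , All-resp-⊆ L′⊑L v∈TL


module Ramsey where

  open import Data.Nat using (_*_)
  open Counting

  Homogeneous : ∀ {A : Set} {c} → (List A → Fin c) → ℕ → Fin c → List A → Set
  Homogeneous χ r col H = ∀ {Z} → Z ⊑ H → length Z ≡ r → χ Z ≡ col

  Homogeneous-⊑ : ∀ {A : Set} {c} {χ : List A → Fin c} {r col H H′} →
    H′ ⊑ H → Homogeneous χ r col H → Homogeneous χ r col H′
  Homogeneous-⊑ H′⊑H hom Z⊑H′ = hom (⊆-trans Z⊑H′ H′⊑H)

  IsRamseyNumber : (r c h n : ℕ) → Set₁
  IsRamseyNumber r c h n = ∀ {A : Set} (P : List A) → n ≤ length P → (χ : List A → Fin c) →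
    ∃[ H ] H ⊑ P × length H ≡ h × ∃[ col ] Homogeneous χ r col H

  -- Each element fixes the colour of all (r+1)-sets that it starts.
  data Prehomogeneous {A : Set} {c} (χ : List A → Fin c) (r : ℕ) : List (A × Fin c) → Set where
    []  : Prehomogeneous χ r []
    _∷_ : ∀ {a col ps} → Homogeneous (χ ∘ (a ∷_)) r col (map proj₁ ps) →
          Prehomogeneous χ r ps → Prehomogeneous χ r ((a , col) ∷ ps)

  Prehomogeneous-⊑ : ∀ {A : Set} {c} {χ : List A → Fin c} {r ps qs} →
    qs ⊑ ps → Prehomogeneous χ r ps → Prehomogeneous χ r qs
  Prehomogeneous-⊑ []             []          = []
  Prehomogeneous-⊑ (_ ∷ʳ qs⊑ps)   (_ ∷ pre)   = Prehomogeneous-⊑ qs⊑ps pre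
  Prehomogeneous-⊑ (refl ∷ qs⊑ps) (hom ∷ pre) =
    Homogeneous-⊑ (map⁺ proj₁ qs⊑ps) hom ∷ Prehomogeneous-⊑ qs⊑ps pre

  Prehomogeneous⇒Homogeneous : ∀ {A : Set} {c} {χ : List A → Fin c} {r col ps} →
    Prehomogeneous χ r ps → All (λ p → proj₂ p ≡ col) ps → Homogeneous χ (suc r) col (map proj₁ ps)
  Prehomogeneous⇒Homogeneous []        []         []          ()
  Prehomogeneous⇒Homogeneous (_ ∷ pre) (_ ∷ cols) (_ ∷ʳ Z⊑)   |Z| = Prehomogeneous⇒Homogeneous pre cols Z⊑ |Z|
  Prehomogeneous⇒Homogeneous (hom ∷ _) (refl ∷ _) (refl ∷ Z⊑) |Z| = hom Z⊑ (suc-injective |Z|)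

  ForcesPrehomogeneous : (r c L n : ℕ) → Set₁
  ForcesPrehomogeneous r c L n = ∀ {A : Set} (P : List A) → n ≤ length P → (χ : List A → Fin c) →
    ∃[ ps ] map proj₁ ps ⊑ P × length ps ≡ L × Prehomogeneous χ r ps

  prehomogeneous-sequence : ∀ {r c} → (∀ h → ∃ (IsRamseyNumber r c h)) → ∀ L → ∃ (ForcesPrehomogeneous r c L)
  prehomogeneous-sequence ramsey-r zero = 0 , λ P _ _ → [] , []⊆-universal P , refl , []
  prehomogeneous-sequence {r} {c} ramsey-r (suc L) = suc n , extend
    where
    rest : ∃ (ForcesPrehomogeneous r c L)
    rest = prehomogeneous-sequence ramsey-r L
    n : ℕ
    n = proj₁ (ramsey-r (proj₁ rest))
    extend : ForcesPrehomogeneous r c (suc L) (suc n)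
    extend (a ∷ P) (s≤s n≤P) χ with proj₂ (ramsey-r (proj₁ rest)) P n≤P (χ ∘ (a ∷_))
    ... | H , H⊑P , |H| , col , hom with proj₂ rest H (≤-reflexive (sym |H|)) χ
    ... | ps , ps⊑H , |ps| , pre =
      (a , col) ∷ ps , refl ∷ ⊆-trans ps⊑H H⊑P , cong suc |ps| , Homogeneous-⊑ ps⊑H hom ∷ pre

  ramsey : ∀ r c h → ∃ (IsRamseyNumber r c h)
  ramsey zero    c h = h , λ P h≤P χ → let H , H⊑P , |H| = sublist-of-length P h≤P in
    H , H⊑P , |H| , χ [] , λ { {[]} _ _ → refl }
  ramsey (suc r) c h = proj₁ sequence , homogeneous
    where
    sequence : ∃ (ForcesPrehomogeneous r c (suc (c * h)))
    sequence = prehomogeneous-sequence (ramsey r c) (suc (c * h))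
    homogeneous : IsRamseyNumber (suc r) c h (proj₁ sequence)
    homogeneous P n≤P χ with proj₂ sequence P n≤P χ
    ... | ps , ps⊑P , |ps| , pre with pigeonhole h proj₂ ps (≤-reflexive (sym |ps|))
    ... | col , qs , qs⊑ps , h<qs , cols with sublist-of-length qs (<⇒≤ h<qs)
    ... | qs′ , qs′⊑qs , |qs′| =
      map proj₁ qs′ , ⊆-trans (map⁺ proj₁ (⊆-trans qs′⊑qs qs⊑ps)) ps⊑P , trans (length-map proj₁ qs′) |qs′| ,
      col , Prehomogeneous⇒Homogeneous (Prehomogeneous-⊑ (⊆-trans qs′⊑qs qs⊑ps) pre) (All-resp-⊆ qs′⊑qs cols)


module SortedSubsets where

  AllPairs-resp-⊑ : ∀ {A : Set} {R : A → A → Set} {xs ys} → xs ⊑ ys → AllPairs R ys → AllPairs R xs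
  AllPairs-resp-⊑ []             []         = []
  AllPairs-resp-⊑ (_ ∷ʳ xs⊑ys)   (_ ∷ rys)  = AllPairs-resp-⊑ xs⊑ys rys
  AllPairs-resp-⊑ (refl ∷ xs⊑ys) (rx ∷ rys) = All-resp-⊆ xs⊑ys rx ∷ AllPairs-resp-⊑ xs⊑ys rys

  AllPairs-++⁻ : ∀ {A : Set} {R : A → A → Set} xs {ys x y} → AllPairs R (xs ++ ys) → x ∈ₗ xs → y ∈ₗ ys → R x y
  AllPairs-++⁻ (_ ∷ xs) (rx ∷ _)  (here refl)  y∈ys = All.lookup rx (∈-++⁺ʳ xs y∈ys)
  AllPairs-++⁻ (_ ∷ xs) (_ ∷ rxs) (there x∈xs) y∈ys = AllPairs-++⁻ xs rxs x∈xs y∈ys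

  Sorted : ∀ {n} → List (Fin n) → Set
  Sorted = AllPairs _<ᶠ_

  Sorted⇒Unique : ∀ {n} {xs : List (Fin n)} → Sorted xs → Unique xs
  Sorted⇒Unique = AllPairs.map λ x<y x≡y → Fin.<-irrefl x≡y x<y

  sorted-allFin : ∀ n → Sorted (allFin n)
  sorted-allFin n = tabulate⁺-< id

  ⟦_⟧ : ∀ {n} → List (Fin n) → Subset n
  ⟦ [] ⟧     = ⊥
  ⟦ x ∷ xs ⟧ = ⁅ x ⁆ ∪ ⟦ xs ⟧

  ∈⟦⟧⁺ : ∀ {n} {x : Fin n} {xs} → x ∈ₗ xs → x ∈ ⟦ xs ⟧
  ∈⟦⟧⁺ {x = x}      (here refl)  = x∈p∪q⁺ (inj₁ (x∈⁅x⁆ x))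
  ∈⟦⟧⁺ {xs = y ∷ _} (there x∈xs) = x∈p∪q⁺ {p = ⁅ y ⁆} (inj₂ (∈⟦⟧⁺ x∈xs))

  ∈⟦⟧⁻ : ∀ {n} {x : Fin n} xs → x ∈ ⟦ xs ⟧ → x ∈ₗ xs
  ∈⟦⟧⁻ []       x∈⊥ = contradiction x∈⊥ ∉⊥
  ∈⟦⟧⁻ (y ∷ xs) x∈  with x∈p∪q⁻ ⁅ y ⁆ ⟦ xs ⟧ x∈
  ... | inj₁ x∈⁅y⁆ = here (x∈⁅y⁆⇒x≡y y x∈⁅y⁆)
  ... | inj₂ x∈xs  = there (∈⟦⟧⁻ xs x∈xs)

  ∣⁅x⁆∪p∣≡1+∣p∣ : ∀ {n} (x : Fin n) p → x ∉ p → ∣ ⁅ x ⁆ ∪ p ∣ ≡ suc ∣ p ∣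
  ∣⁅x⁆∪p∣≡1+∣p∣ zero    (inside  ∷ p) x∉p = contradiction here x∉p
  ∣⁅x⁆∪p∣≡1+∣p∣ zero    (outside ∷ p) _   = cong (suc ∘ ∣_∣) (∪-identityˡ p)
  ∣⁅x⁆∪p∣≡1+∣p∣ (suc x) (inside  ∷ p) x∉p = cong suc (∣⁅x⁆∪p∣≡1+∣p∣ x p (x∉p ∘ there))
  ∣⁅x⁆∪p∣≡1+∣p∣ (suc x) (outside ∷ p) x∉p = ∣⁅x⁆∪p∣≡1+∣p∣ x p (x∉p ∘ there)

  ∣⟦xs⟧∣≡length : ∀ {n} {xs : List (Fin n)} → Unique xs → ∣ ⟦ xs ⟧ ∣ ≡ length xs
  ∣⟦xs⟧∣≡length {n} []              = ∣⊥∣≡0 n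
  ∣⟦xs⟧∣≡length {xs = x ∷ xs} (x∉xs ∷ unique) =
    trans (∣⁅x⁆∪p∣≡1+∣p∣ x ⟦ xs ⟧ (λ x∈ → All.lookup x∉xs (∈⟦⟧⁻ xs x∈) refl)) (cong suc (∣⟦xs⟧∣≡length unique))

  ⟦filter-∈⟧ : ∀ {n} {X : Subset n} Z → X ⊆ ⟦ Z ⟧ → ⟦ filter (_∈? X) Z ⟧ ≡ X
  ⟦filter-∈⟧ {X = X} Z X⊆Z = ⊆-antisym
    (λ x∈ → proj₂ (∈-filter⁻ (_∈? X) {xs = Z} (∈⟦⟧⁻ (filter (_∈? X) Z) x∈)))
    (λ x∈X → ∈⟦⟧⁺ (∈-filter⁺ (_∈? X) (∈⟦⟧⁻ Z (X⊆Z x∈X)) x∈X))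

  ∈-below⁺ : ∀ {n} {x y : Fin n} → x <ᶠ y → x ∈ below y
  ∈-below⁺ {x = x} {y} x<y = lookup⇒[]= x (below y) (trans (lookup∘tabulate _ x) (dec-true (x Fin.<? y) x<y))

  ∈-below⁻ : ∀ {n} {x y : Fin n} → x ∈ below y → x <ᶠ y
  ∈-below⁻ {x = x} {y} x∈ = true-witness (x Fin.<? y) (trans (sym (lookup∘tabulate _ x)) ([]=⇒lookup x∈))
    where
    true-witness : ∀ {P : Set} (p? : Dec P) → does p? ≡ true → P
    true-witness (yes p) _ = p

  Cofinal Coinitial : ∀ {n} → List (Fin n) → List (Fin n) → Set
  Cofinal   X Z = ∀ {z} → z ∈ₗ Z → z ∉ₗ X → ∃[ x ] x ∈ₗ X × z <ᶠ x
  Coinitial X Z = ∀ {z} → z ∈ₗ Z → z ∉ₗ X → ∃[ x ] x ∈ₗ X × x <ᶠ z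

  module Gap {n} {Z₁ L Z₂ X₁ X₂ : List (Fin n)}
    (sorted : Sorted (Z₁ ++ L ++ Z₂)) (X₁⊑Z₁ : X₁ ⊑ Z₁) (X₂⊑Z₂ : X₂ ⊑ Z₂) where

    X : Subset n
    X = ⟦ X₁ ++ X₂ ⟧

    private
      Z₁<LZ₂ : ∀ {z w} → z ∈ₗ Z₁ → w ∈ₗ L ++ Z₂ → z <ᶠ w
      Z₁<LZ₂ = AllPairs-++⁻ Z₁ sorted

      L<Z₂ : ∀ {z w} → z ∈ₗ L → w ∈ₗ Z₂ → z <ᶠ w
      L<Z₂ = AllPairs-++⁻ L (AllPairs-resp-⊑ (++⁺ˡ Z₁ ⊆-refl) sorted)

      X₁<L : ∀ {x y} → x ∈ₗ X₁ → y ∈ₗ L → x <ᶠ y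
      X₁<L x∈X₁ y∈L = Z₁<LZ₂ (Any-resp-⊆ X₁⊑Z₁ x∈X₁) (∈-++⁺ˡ y∈L)

      X₁<Z₂ : ∀ {x y} → x ∈ₗ X₁ → y ∈ₗ Z₂ → x <ᶠ y
      X₁<Z₂ x∈X₁ y∈Z₂ = Z₁<LZ₂ (Any-resp-⊆ X₁⊑Z₁ x∈X₁) (∈-++⁺ʳ L y∈Z₂)

      ∣⟦X₁⟧∣ : ∣ ⟦ X₁ ⟧ ∣ ≡ length X₁
      ∣⟦X₁⟧∣ = ∣⟦xs⟧∣≡length (Sorted⇒Unique (AllPairs-resp-⊑ (⊆-trans X₁⊑Z₁ (++⁺ʳ (L ++ Z₂) ⊆-refl)) sorted))

      below-⊆ : ∀ {y} → (∀ {x} → x ∈ₗ X₂ → y <ᶠ x) → X ∩ below y ⊆ ⟦ X₁ ⟧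
      below-⊆ {y} y<X₂ x∈ with x∈p∩q⁻ X (below y) x∈
      ... | x∈X , x<y with ∈-++⁻ X₁ (∈⟦⟧⁻ _ x∈X)
      ...   | inj₁ x∈X₁ = ∈⟦⟧⁺ x∈X₁
      ...   | inj₂ x∈X₂ = contradiction (∈-below⁻ x<y) (Fin.<-asym (y<X₂ x∈X₂))

      ⊆-below : ∀ {y} → (∀ {x} → x ∈ₗ X₁ → x <ᶠ y) → ⟦ X₁ ⟧ ⊆ X ∩ below y
      ⊆-below X₁<y x∈ = let x∈X₁ = ∈⟦⟧⁻ X₁ x∈ in
        x∈p∩q⁺ (∈⟦⟧⁺ (∈-++⁺ˡ x∈X₁) , ∈-below⁺ (X₁<y x∈X₁))

    in-gap : ∀ {y} → y ∈ₗ L → y ∉ X × countBelow X y ≡ length X₁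
    in-gap {y} y∈L = y∉X , trans (cong ∣_∣ below≡X₁) ∣⟦X₁⟧∣
      where
      below≡X₁ : X ∩ below y ≡ ⟦ X₁ ⟧
      below≡X₁ = ⊆-antisym (below-⊆ (L<Z₂ y∈L ∘ Any-resp-⊆ X₂⊑Z₂)) (⊆-below (λ x∈X₁ → X₁<L x∈X₁ y∈L))
      y∉X : y ∉ X
      y∉X y∈X with ∈-++⁻ X₁ (∈⟦⟧⁻ _ y∈X)
      ... | inj₁ y∈X₁ = Fin.<-irrefl refl (X₁<L y∈X₁ y∈L)
      ... | inj₂ y∈X₂ = Fin.<-irrefl refl (L<Z₂ y∈L (Any-resp-⊆ X₂⊑Z₂ y∈X₂))

    -- Some x ∈ X₁ above y is not counted when y is left of L; some x ∈ X₂ below y is counted when y is right of L.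
    outside-gap : Cofinal X₁ Z₁ → Coinitial X₂ Z₂ → ∀ {y} → y ∈ₗ Z₁ ++ L ++ Z₂ → y ∉ X →
      countBelow X y ≡ length X₁ → y ∈ₗ L
    outside-gap cofinal coinitial {y} y∈Z y∉X count with ∈-++⁻ Z₁ y∈Z
    ... | inj₁ y∈Z₁ = contradiction count (<⇒≢ (subst (countBelow X y <_) ∣⟦X₁⟧∣ count<))
      where
      count< : countBelow X y < ∣ ⟦ X₁ ⟧ ∣
      count< with cofinal y∈Z₁ (y∉X ∘ ∈⟦⟧⁺ ∘ ∈-++⁺ˡ)
      ... | x , x∈X₁ , y<x = p⊂q⇒∣p∣<∣q∣
        ( below-⊆ (λ x∈X₂ → Z₁<LZ₂ y∈Z₁ (∈-++⁺ʳ L (Any-resp-⊆ X₂⊑Z₂ x∈X₂)))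
        , x , ∈⟦⟧⁺ x∈X₁ , λ x∈ → Fin.<-asym y<x (∈-below⁻ (proj₂ (x∈p∩q⁻ X (below y) x∈))))
    ... | inj₂ y∈LZ₂ with ∈-++⁻ L y∈LZ₂
    ...   | inj₁ y∈L  = y∈L
    ...   | inj₂ y∈Z₂ = contradiction (sym count) (<⇒≢ (subst (_< countBelow X y) ∣⟦X₁⟧∣ count>))
      where
      count> : ∣ ⟦ X₁ ⟧ ∣ < countBelow X y
      count> with coinitial y∈Z₂ (y∉X ∘ ∈⟦⟧⁺ ∘ ∈-++⁺ʳ X₁)
      ... | x , x∈X₂ , x<y = p⊂q⇒∣p∣<∣q∣
        ( ⊆-below (λ x∈X₁ → X₁<Z₂ x∈X₁ y∈Z₂)
        , x , x∈p∩q⁺ (∈⟦⟧⁺ (∈-++⁺ʳ X₁ x∈X₂) , ∈-below⁺ x<y)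
        , λ x∈ → Fin.<-irrefl refl (X₁<Z₂ (∈⟦⟧⁻ X₁ x∈) (Any-resp-⊆ X₂⊑Z₂ x∈X₂)))


module Patterns where

  open SortedSubsets

  select : ∀ {A : Set} → List Bool → List A → List A
  select (true  ∷ θ) (z ∷ Z) = z ∷ select θ Z
  select (false ∷ θ) (z ∷ Z) = select θ Z
  select _           _       = []

  trues : List Bool → ℕ
  trues []          = 0
  trues (true  ∷ θ) = suc (trues θ)
  trues (false ∷ θ) = trues θ

  select-⊑ : ∀ {A : Set} θ (Z : List A) → select θ Z ⊑ Z
  select-⊑ []          Z       = []⊆-universal Z
  select-⊑ (true  ∷ θ) []      = []
  select-⊑ (false ∷ θ) []      = []
  select-⊑ (true  ∷ θ) (z ∷ Z) = refl ∷ select-⊑ θ Z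
  select-⊑ (false ∷ θ) (z ∷ Z) = z ∷ʳ select-⊑ θ Z

  length-select : ∀ {A : Set} θ (Z : List A) → length θ ≡ length Z → length (select θ Z) ≡ trues θ
  length-select []          []      _  = refl
  length-select (true  ∷ θ) (z ∷ Z) eq = cong suc (length-select θ Z (suc-injective eq))
  length-select (false ∷ θ) (z ∷ Z) eq = length-select θ Z (suc-injective eq)

  select-++ : ∀ {A : Set} α θ (Z₁ Z : List A) → length α ≡ length Z₁ →
    select (α ++ θ) (Z₁ ++ Z) ≡ select α Z₁ ++ select θ Z
  select-++ []          θ []       Z _  = refl
  select-++ (true  ∷ α) θ (z ∷ Z₁) Z eq = cong (z ∷_) (select-++ α θ Z₁ Z (suc-injective eq))
  select-++ (false ∷ α) θ (z ∷ Z₁) Z eq = select-++ α θ Z₁ Z (suc-injective eq)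

  select-falses : ∀ {A : Set} ℓ (Z : List A) → select (replicate ℓ false) Z ≡ []
  select-falses zero    Z       = refl
  select-falses (suc ℓ) []      = refl
  select-falses (suc ℓ) (z ∷ Z) = select-falses ℓ Z

  select-characteristic : ∀ {A : Set} {P : A → Set} (P? : Decidable P) xs →
    select (map (does ∘ P?) xs) xs ≡ filter P? xs
  select-characteristic P? []       = refl
  select-characteristic P? (x ∷ xs) with does (P? x)
  ... | true  = cong (x ∷_) (select-characteristic P? xs)
  ... | false = select-characteristic P? xs

  trues-++ : ∀ α β → trues (α ++ β) ≡ trues α + trues β
  trues-++ []          β = refl
  trues-++ (true  ∷ α) β = cong suc (trues-++ α β)
  trues-++ (false ∷ α) β = trues-++ α β

  trues-falses : ∀ ℓ → trues (replicate ℓ false) ≡ 0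
  trues-falses zero    = refl
  trues-falses (suc ℓ) = trues-falses ℓ

  boolLists : ℕ → List (List Bool)
  boolLists zero    = [ [] ]
  boolLists (suc m) = map (true ∷_) (boolLists m) ++ map (false ∷_) (boolLists m)

  ∈-boolLists : ∀ θ → θ ∈ₗ boolLists (length θ)
  ∈-boolLists []          = here refl
  ∈-boolLists (true  ∷ θ) = ∈-++⁺ˡ (∈-map⁺ (true ∷_) (∈-boolLists θ))
  ∈-boolLists (false ∷ θ) = ∈-++⁺ʳ (map (true ∷_) (boolLists (length θ))) (∈-map⁺ (false ∷_) (∈-boolLists θ))

  boolLists-length : ∀ m {θ} → θ ∈ₗ boolLists m → length θ ≡ m
  boolLists-length zero    (here refl) = refl
  boolLists-length (suc m) θ∈ with ∈-++⁻ (map (true ∷_) (boolLists m)) θ∈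
  ... | inj₁ θ∈ᵗ with ∈-map⁻ (true ∷_) θ∈ᵗ
  ...   | _ , θ′∈ , refl = cong suc (boolLists-length m θ′∈)
  boolLists-length (suc m) θ∈ | inj₂ θ∈ᶠ with ∈-map⁻ (false ∷_) θ∈ᶠ
  ...   | _ , θ′∈ , refl = cong suc (boolLists-length m θ′∈)

  EmptyOrLastTrue EmptyOrFirstTrue : List Bool → Set
  EmptyOrLastTrue  α = α ≡ [] ⊎ ∃[ α′ ] α ≡ α′ ++ [ true ]
  EmptyOrFirstTrue β = β ≡ [] ⊎ ∃[ β′ ] β ≡ true ∷ β′

  -- The gap is the maximal run of falses after the j-th true of θ.
  record GapSplit (j : ℕ) (θ : List Bool) : Set where
    field
      before       : List Bool
      gap          : ℕ
      after        : List Bool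
      split        : θ ≡ before ++ replicate gap false ++ after
      trues-before : trues before ≡ j
      before-last  : EmptyOrLastTrue before
      after-first  : EmptyOrFirstTrue after

  leading-falses : ∀ θ → ∃[ ℓ ] ∃[ β ] θ ≡ replicate ℓ false ++ β × EmptyOrFirstTrue β
  leading-falses []          = 0 , [] , refl , inj₁ refl
  leading-falses (true  ∷ θ) = 0 , true ∷ θ , refl , inj₂ (θ , refl)
  leading-falses (false ∷ θ) with leading-falses θ
  ... | ℓ , β , θ≡ , first = suc ℓ , β , cong (false ∷_) θ≡ , first

  true∷-last : ∀ {α} → EmptyOrLastTrue α → EmptyOrLastTrue (true ∷ α)
  true∷-last (inj₁ refl)       = inj₂ ([] , refl)
  true∷-last (inj₂ (α , refl)) = inj₂ (true ∷ α , refl)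

  ∷-last : ∀ b {α} → α ≢ [] → EmptyOrLastTrue α → EmptyOrLastTrue (b ∷ α)
  ∷-last b α≢[] (inj₁ α≡[])       = contradiction α≡[] α≢[]
  ∷-last b _    (inj₂ (α , refl)) = inj₂ (b ∷ α , refl)

  gap-split : ∀ j θ → j ≤ trues θ → GapSplit j θ
  gap-split zero θ _ with leading-falses θ
  ... | ℓ , β , θ≡ , first = record
    { before = [] ; gap = ℓ ; after = β ; split = θ≡
    ; trues-before = refl ; before-last = inj₁ refl ; after-first = first }
  gap-split (suc j) (true ∷ θ) (s≤s j≤θ) = record
    { before = true ∷ before ; gap = gap ; after = after ; split = cong (true ∷_) split
    ; trues-before = cong suc trues-before ; before-last = true∷-last before-last ; after-first = after-first }
    where open GapSplit (gap-split j θ j≤θ)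
  gap-split (suc j) (false ∷ θ) j<θ = record
    { before = false ∷ before ; gap = gap ; after = after ; split = cong (false ∷_) split
    ; trues-before = trues-before ; before-last = ∷-last false before≢[] before-last ; after-first = after-first }
    where
    open GapSplit (gap-split (suc j) θ j<θ)
    before≢[] : before ≢ []
    before≢[] before≡[] = 0≢1+n (trans (sym (cong trues before≡[])) trues-before)

  module _ (α β : List Bool) (ℓ : ℕ) where

    length-gapped : length (α ++ replicate ℓ false ++ β) ≡ length α + (ℓ + length β)
    length-gapped = begin
      length (α ++ replicate ℓ false ++ β)               ≡⟨ length-++ α ⟩
      length α + length (replicate ℓ false ++ β)         ≡⟨ cong (length α +_) (length-++ (replicate ℓ false)) ⟩
      length α + (length (replicate ℓ false) + length β) ≡⟨ cong (λ l → length α + (l + length β)) (length-replicate ℓ) ⟩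
      length α + (ℓ + length β)                          ∎
      where open ≡-Reasoning

    trues-gapped : trues (α ++ replicate ℓ false ++ β) ≡ trues α + trues β
    trues-gapped = begin
      trues (α ++ replicate ℓ false ++ β)              ≡⟨ trues-++ α _ ⟩
      trues α + trues (replicate ℓ false ++ β)         ≡⟨ cong (trues α +_) (trues-++ (replicate ℓ false) β) ⟩
      trues α + (trues (replicate ℓ false) + trues β)  ≡⟨ cong (λ c → trues α + (c + trues β)) (trues-falses ℓ) ⟩
      trues α + trues β                                ∎
      where open ≡-Reasoning

    select-gapped : ∀ {A : Set} (Z₁ L Z₂ : List A) → length α ≡ length Z₁ → length L ≡ ℓ →
      select (α ++ replicate ℓ false ++ β) (Z₁ ++ L ++ Z₂) ≡ select α Z₁ ++ select β Z₂
    select-gapped Z₁ L Z₂ |α| |L| = begin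
      select (α ++ replicate ℓ false ++ β) (Z₁ ++ L ++ Z₂)            ≡⟨ select-++ α _ Z₁ _ |α| ⟩
      select α Z₁ ++ select (replicate ℓ false ++ β) (L ++ Z₂)        ≡⟨ cong (select α Z₁ ++_) (select-++ (replicate ℓ false) β L Z₂ |falses|) ⟩
      select α Z₁ ++ select (replicate ℓ false) L ++ select β Z₂      ≡⟨ cong (λ s → select α Z₁ ++ s ++ select β Z₂) (select-falses ℓ L) ⟩
      select α Z₁ ++ select β Z₂                                      ∎
      where
      open ≡-Reasoning
      |falses| : length (replicate ℓ false) ≡ length L
      |falses| = trans (length-replicate ℓ) (sym |L|)

  select-cofinal : ∀ {n} α {Z : List (Fin n)} → Sorted Z → length α ≡ length Z → EmptyOrLastTrue α →
    Cofinal (select α Z) Z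
  select-cofinal _ {[]}    _ _  (inj₁ refl) ()
  select-cofinal _ {_ ∷ _} _ () (inj₁ refl)
  select-cofinal _ {Z} sorted |α|≡|Z| (inj₂ (α′ , refl)) with initLast Z
  ... | [] = contradiction (trans (sym (length-++ α′)) |α|≡|Z|) (m<n⇒n≢0 (m≤n+m 1 (length α′)))
  ... | Z′ ∷ʳ′ z = cofinal
    where
    |α′|≡|Z′| : length α′ ≡ length Z′
    |α′|≡|Z′| = +-cancelʳ-≡ 1 (length α′) (length Z′) (trans (sym (length-++ α′)) (trans |α|≡|Z| (length-++ Z′)))
    z∈ : z ∈ₗ select (α′ ++ [ true ]) (Z′ ++ [ z ])
    z∈ = subst (z ∈ₗ_) (sym (select-++ α′ [ true ] Z′ [ z ] |α′|≡|Z′|)) (∈-++⁺ʳ (select α′ Z′) (here refl))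
    cofinal : Cofinal (select (α′ ++ [ true ]) (Z′ ++ [ z ])) (Z′ ++ [ z ])
    cofinal w∈ w∉ with ∈-++⁻ Z′ w∈
    ... | inj₁ w∈Z′        = z , z∈ , AllPairs-++⁻ Z′ sorted w∈Z′ (here refl)
    ... | inj₂ (here refl) = contradiction z∈ w∉

  select-coinitial : ∀ {n} β {Z : List (Fin n)} → Sorted Z → length β ≡ length Z → EmptyOrFirstTrue β →
    Coinitial (select β Z) Z
  select-coinitial _ {[]}    _ _  (inj₁ refl) ()
  select-coinitial _ {_ ∷ _} _ () (inj₁ refl)
  select-coinitial _ {z ∷ Z} (z<Z ∷ _) _ (inj₂ (β′ , refl)) (here refl) w∉ = contradiction (here refl) w∉
  select-coinitial _ {z ∷ Z} (z<Z ∷ _) _ (inj₂ (β′ , refl)) (there w∈Z) _  = z , here refl , All.lookup z<Z w∈Z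


module Realisation where

  open import Data.Nat using (_*_)
  open Counting
  open Ramsey
  open SortedSubsets
  open Patterns

  witnessIndex : ∀ {A : Set} {P : A → Set} {xs} → Dec (Any P xs) → Fin (suc (length xs))
  witnessIndex (yes p) = suc (index p)
  witnessIndex (no _)  = zero

  witnessIndex-zero : ∀ {A : Set} {P : A → Set} {xs} (d : Dec (Any P xs)) → witnessIndex d ≡ zero → ¬ Any P xs
  witnessIndex-zero (no ¬p) _ = ¬p

  witnessIndex-suc : ∀ {A : Set} {P : A → Set} {xs i} (d : Dec (Any P xs)) → witnessIndex d ≡ suc i → P (lookup xs i)
  witnessIndex-suc (yes p) refl = lookup-index p

  blocks-fit : ∀ D a ℓ b {m} → a + (ℓ + b) ≡ m → a + (D * ℓ + b) ≤ m + D * m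
  blocks-fit D a ℓ b refl = begin
    a + (D * ℓ + b)  ≡⟨ +-leftComm a (D * ℓ) b ⟩
    D * ℓ + (a + b)  ≤⟨ +-mono-≤ (*-monoʳ-≤ D ℓ≤m) a+b≤m ⟩
    D * m + m        ≡⟨ +-comm (D * m) m ⟩
    m + D * m        ∎
    where
    open ≤-Reasoning
    m : ℕ
    m = a + (ℓ + b)
    ℓ≤m : ℓ ≤ m
    ℓ≤m = ≤-trans (m≤m+n ℓ b) (m≤n+m (ℓ + b) a)
    a+b≤m : a + b ≤ m
    a+b≤m = +-monoʳ-≤ a (m≤n+m b ℓ)

  LinkSets : ∀ {k N} → ReducedGraph k N → Set
  LinkSets {N = N} G = (X : Subset N) → Fin N → Subset (ReducedGraph.size G X)

  Dense : ∀ {k N} (t : ℕ) (G : ReducedGraph k N) → LinkSets G → ℕ → Set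
  Dense {k} t G S D = ∀ X y → ∣ X ∣ ≡ k ∸ 1 → y ∉ X → countBelow X y ≡ t ∸ 1 → ReducedGraph.size G X ≤ D * ∣ S X y ∣

  CommonVertices : ∀ {k N} (t : ℕ) (G : ReducedGraph k N) → LinkSets G → ℕ → Set
  CommonVertices {k} {N} t G S m = Σ (Subset N) λ M → ∣ M ∣ ≡ m ×
    Σ ((X : Subset N) → X ⊆ M → ∣ X ∣ ≡ k ∸ 1 → Fin (ReducedGraph.size G X)) λ v →
      (X : Subset N) (XM : X ⊆ M) (cX : ∣ X ∣ ≡ k ∸ 1) (y : Fin N) →
        y ∈ M → y ∉ X → countBelow X y ≡ t ∸ 1 → v X XM cX ∈ S X y

  module Construction {k N} (t : ℕ) (G : ReducedGraph k N) (S : LinkSets G)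
    (D : ℕ) .{{_ : NonZero D}} (dense : Dense t G S D) where

    open ReducedGraph G using (size; nonempty)

    Good : Subset N → Subset N → Set
    Good X M = ∃[ v ] ∀ y → y ∈ M → y ∉ X → countBelow X y ≡ t ∸ 1 → v ∈ S X y

    good? : ∀ X M → Dec (Good X M)
    good? X M = Fin.any? λ v → Fin.all? λ y →
      (y ∈? M) →-dec (¬? (y ∈? X) →-dec ((countBelow X y ≟ t ∸ 1) →-dec (v ∈? S X y)))

    -- X is placed by α on Z₁ and by β on Z₂; B holds the candidates for its t-th gap.
    module Blocks {α β : List Bool} {Z₁ B Z₂ : List (Fin N)}
      (sorted : Sorted (Z₁ ++ B ++ Z₂)) (|α| : length α ≡ length Z₁) (|β| : length β ≡ length Z₂)
      (trues-α : trues α ≡ t ∸ 1) (trues-αβ : trues α + trues β ≡ k ∸ 1)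
      (α-last : EmptyOrLastTrue α) (β-first : EmptyOrFirstTrue β) where

      X : Subset N
      X = ⟦ select α Z₁ ++ select β Z₂ ⟧

      private
        |X₁| : length (select α Z₁) ≡ t ∸ 1
        |X₁| = trans (length-select α Z₁ |α|) trues-α

        module InB = Gap sorted (select-⊑ α Z₁) (select-⊑ β Z₂)

      ∣X∣ : ∣ X ∣ ≡ k ∸ 1
      ∣X∣ = begin
        ∣ X ∣                                        ≡⟨ ∣⟦xs⟧∣≡length (Sorted⇒Unique (AllPairs-resp-⊑ X⊑Z sorted)) ⟩
        length (select α Z₁ ++ select β Z₂)          ≡⟨ length-++ (select α Z₁) ⟩
        length (select α Z₁) + length (select β Z₂)  ≡⟨ cong₂ _+_ (length-select α Z₁ |α|) (length-select β Z₂ |β|) ⟩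
        trues α + trues β                            ≡⟨ trues-αβ ⟩
        k ∸ 1                                        ∎
        where
        open ≡-Reasoning
        X⊑Z : select α Z₁ ++ select β Z₂ ⊑ Z₁ ++ B ++ Z₂
        X⊑Z = ++⁺ (select-⊑ α Z₁) (++⁺ˡ B (select-⊑ β Z₂))

      candidates-dense : All (λ y → size X ≤ D * ∣ S X y ∣) B
      candidates-dense = All.tabulate λ y∈B → let y∉X , count = InB.in-gap y∈B in
        dense X _ ∣X∣ y∉X (trans count |X₁|)

      good-on-gap : ∀ {L v} → L ⊑ B → All (λ y → v ∈ S X y) L → Good X ⟦ Z₁ ++ L ++ Z₂ ⟧
      good-on-gap {L} {v} L⊑B v∈SL = v , λ y y∈Z y∉X count →
        All.lookup v∈SL (InL.outside-gap cofinal coinitial (∈⟦⟧⁻ _ y∈Z) y∉X (trans count (sym |X₁|)))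
        where
        sortedL : Sorted (Z₁ ++ L ++ Z₂)
        sortedL = AllPairs-resp-⊑ (++⁺ (⊆-refl {x = Z₁}) (++⁺ L⊑B (⊆-refl {x = Z₂}))) sorted
        module InL = Gap sortedL (select-⊑ α Z₁) (select-⊑ β Z₂)
        cofinal : Cofinal (select α Z₁) Z₁
        cofinal = select-cofinal α (AllPairs-resp-⊑ (++⁺ʳ (B ++ Z₂) ⊆-refl) sorted) |α| α-last
        coinitial : Coinitial (select β Z₂) Z₂
        coinitial = select-coinitial β (AllPairs-resp-⊑ (++⁺ˡ Z₁ (++⁺ˡ B ⊆-refl)) sorted) |β| β-first

      gap-realised : ∀ ℓ → D * ℓ ≤ length B → ∃[ L ] L ⊑ B × length L ≡ ℓ × Good X ⟦ Z₁ ++ L ++ Z₂ ⟧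
      gap-realised ℓ Dℓ≤B with common-element D ℓ (S X) B (nonempty X ∣X∣) candidates-dense Dℓ≤B
      ... | v , L , L⊑B , |L| , v∈SL = L , L⊑B , |L| , good-on-gap L⊑B v∈SL

    GoodRealisation : List (Fin N) → List Bool → Set
    GoodRealisation H θ = ∃[ Z ] Z ⊑ H × length Z ≡ length θ × Good ⟦ select θ Z ⟧ ⟦ Z ⟧

    gapped-realisation : ∀ α ℓ β → trues α ≡ t ∸ 1 → trues (α ++ replicate ℓ false ++ β) ≡ k ∸ 1 →
      EmptyOrLastTrue α → EmptyOrFirstTrue β → (H : List (Fin N)) → Sorted H →
      length α + (D * ℓ + length β) ≤ length H → GoodRealisation H (α ++ replicate ℓ false ++ β)
    gapped-realisation α ℓ β trues-α trues-θ α-last β-first H sorted fits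
      with split-at (length α) H fits
    ... | Z₁ , rest₁ , refl , |Z₁| , fits₁ with split-at (D * ℓ) rest₁ fits₁
    ... | B , rest₂ , refl , |B| , fits₂ with split-at (length β) {0} rest₂ (subst (_≤ length rest₂) (sym (+-identityʳ _)) fits₂)
    ... | Z₂ , rest , refl , |Z₂| , _ with Blocks.gap-realised sorted-blocks (sym |Z₁|) (sym |Z₂|) trues-α
          (trans (sym (trues-gapped α β ℓ)) trues-θ) α-last β-first ℓ (≤-reflexive (sym |B|))
      where
      sorted-blocks : Sorted (Z₁ ++ B ++ Z₂)
      sorted-blocks = AllPairs-resp-⊑ (++⁺ (⊆-refl {x = Z₁}) (++⁺ (⊆-refl {x = B}) (++⁺ʳ rest ⊆-refl))) sorted
    ... | L , L⊑B , |L| , good = Z₁ ++ L ++ Z₂ , ++⁺ (⊆-refl {x = Z₁}) (++⁺ L⊑B (++⁺ʳ rest ⊆-refl)) , |Z|≡|θ| ,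
      subst (λ X → Good ⟦ X ⟧ ⟦ Z₁ ++ L ++ Z₂ ⟧) (sym (select-gapped α β ℓ Z₁ L Z₂ (sym |Z₁|) |L|)) good
      where
      |Z|≡|θ| : length (Z₁ ++ L ++ Z₂) ≡ length (α ++ replicate ℓ false ++ β)
      |Z|≡|θ| = begin
        length (Z₁ ++ L ++ Z₂)                ≡⟨ length-++ Z₁ ⟩
        length Z₁ + length (L ++ Z₂)          ≡⟨ cong (length Z₁ +_) (length-++ L) ⟩
        length Z₁ + (length L + length Z₂)    ≡⟨ cong₂ _+_ |Z₁| (cong₂ _+_ |L| |Z₂|) ⟩
        length α + (ℓ + length β)             ≡⟨ length-gapped α β ℓ ⟨
        length (α ++ replicate ℓ false ++ β)  ∎
        where open ≡-Reasoning

    good-realisation : t ≤ k → (H : List (Fin N)) → Sorted H → ∀ θ → length θ + D * length θ ≤ length H →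
      trues θ ≡ k ∸ 1 → GoodRealisation H θ
    good-realisation t≤k H sorted θ fits trues-θ = subst (GoodRealisation H) (sym split)
      (gapped-realisation before gap after trues-before (trans (cong trues (sym split)) trues-θ)
        before-last after-first H sorted (≤-trans (blocks-fit D (length before) gap (length after) |θ|) fits))
      where
      open GapSplit (gap-split (t ∸ 1) θ (subst (t ∸ 1 ≤_) (sym trues-θ) (∸-monoˡ-≤ 1 t≤k)))
      |θ| : length before + (gap + length after) ≡ length θ
      |θ| = sym (trans (cong length split) (length-gapped before after gap))

    module Colouring (m : ℕ) where

      Bad : List (Fin N) → List Bool → Set
      Bad Z θ = trues θ ≡ k ∸ 1 × ¬ Good ⟦ select θ Z ⟧ ⟦ Z ⟧

      bad? : ∀ Z θ → Dec (Bad Z θ)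
      bad? Z θ = (trues θ ≟ k ∸ 1) ×-dec ¬? (good? ⟦ select θ Z ⟧ ⟦ Z ⟧)

      colour : List (Fin N) → Fin (suc (length (boolLists m)))
      colour Z = witnessIndex (any? (bad? Z) (boolLists m))

      colour-zero⇒good : ∀ {Z} → Sorted Z → length Z ≡ m → colour Z ≡ zero →
        ∀ X → X ⊆ ⟦ Z ⟧ → ∣ X ∣ ≡ k ∸ 1 → Good X ⟦ Z ⟧
      colour-zero⇒good {Z} sorted |Z| colour≡0 X X⊆Z ∣X∣ =
        decidable-stable (good? X ⟦ Z ⟧) λ ¬good → witnessIndex-zero _ colour≡0 (bad-pattern ¬good)
        where
        θ : List Bool
        θ = map (does ∘ (_∈? X)) Z
        X≡ : ⟦ select θ Z ⟧ ≡ X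
        X≡ = trans (cong ⟦_⟧ (select-characteristic (_∈? X) Z)) (⟦filter-∈⟧ Z X⊆Z)
        trues-θ : trues θ ≡ k ∸ 1
        trues-θ = begin
          trues θ              ≡⟨ length-select θ Z (length-map _ Z) ⟨
          length (select θ Z)  ≡⟨ ∣⟦xs⟧∣≡length (Sorted⇒Unique (AllPairs-resp-⊑ (select-⊑ θ Z) sorted)) ⟨
          ∣ ⟦ select θ Z ⟧ ∣   ≡⟨ cong ∣_∣ X≡ ⟩
          ∣ X ∣                ≡⟨ ∣X∣ ⟩
          k ∸ 1                ∎
          where open ≡-Reasoning
        bad-pattern : ¬ Good X ⟦ Z ⟧ → Any (Bad Z) (boolLists m)
        bad-pattern ¬good = subst (λ l → Any (Bad Z) (boolLists l)) (trans (length-map _ Z) |Z|)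
          (Any.map (λ { refl → trues-θ , subst (λ X′ → ¬ Good X′ ⟦ Z ⟧) (sym X≡) ¬good }) (∈-boolLists θ))

      colour-suc-impossible : t ≤ k → ∀ {H i} → Sorted H → m + D * m ≤ length H →
        ¬ Homogeneous colour m (suc i) H
      colour-suc-impossible t≤k {H} {i} sorted fits hom =
        let Z , Z⊑H , |Z| , good = good-realisation t≤k H sorted θ fits′ trues-θ in
        proj₂ (bad Z⊑H (trans |Z| |θ|)) good
        where
        θ : List Bool
        θ = lookup (boolLists m) i
        |θ| : length θ ≡ m
        |θ| = boolLists-length m (∈-lookup i)
        fits′ : length θ + D * length θ ≤ length H
        fits′ = subst (λ l → l + D * l ≤ length H) (sym |θ|) fits
        bad : ∀ {Z} → Z ⊑ H → length Z ≡ m → Bad Z θ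
        bad Z⊑H |Z| = witnessIndex-suc (any? (bad? _) (boolLists m)) (hom Z⊑H |Z|)
        trues-θ : trues θ ≡ k ∸ 1
        trues-θ = let Z , Z⊑H , |Z| = sublist-of-length H (≤-trans (m≤m+n m (D * m)) fits) in
          proj₁ (bad Z⊑H |Z|)

  common-vertices : ∀ D .{{_ : NonZero D}} m k t → t ≤ k →
    ∃[ N ] ∀ (G : ReducedGraph k N) (S : LinkSets G) → Dense t G S D → CommonVertices t G S m
  common-vertices D m k t t≤k = N , from-homogeneous
    where
    R : ∃ (IsRamseyNumber m (suc (length (boolLists m))) (m + D * m))
    R = ramsey m (suc (length (boolLists m))) (m + D * m)
    N : ℕ
    N = proj₁ R
    from-homogeneous : ∀ (G : ReducedGraph k N) (S : LinkSets G) → Dense t G S D → CommonVertices t G S m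
    from-homogeneous G S dense = conclude (proj₂ R (allFin N) (≤-reflexive (sym (length-tabulate id))) colour)
      where
      open Construction t G S D dense
      open Colouring m
      conclude : ∃[ H ] H ⊑ allFin N × length H ≡ m + D * m × ∃[ col ] Homogeneous colour m col H →
        CommonVertices t G S m
      conclude (H , H⊑ , |H| , suc i , hom) =
        ⊥-elim (colour-suc-impossible t≤k (AllPairs-resp-⊑ H⊑ (sorted-allFin N)) (≤-reflexive (sym |H|)) hom)
      conclude (H , H⊑ , |H| , zero , hom) with sublist-of-length H (≤-trans (m≤m+n m (D * m)) (≤-reflexive (sym |H|)))
      ... | Z , Z⊑H , |Z| = ⟦ Z ⟧ , trans (∣⟦xs⟧∣≡length (Sorted⇒Unique sortedZ)) |Z| ,
        (λ X X⊆Z ∣X∣ → proj₁ (good X X⊆Z ∣X∣)) , (λ X X⊆Z ∣X∣ → proj₂ (good X X⊆Z ∣X∣))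
        where
        sortedZ : Sorted Z
        sortedZ = AllPairs-resp-⊑ (⊆-trans Z⊑H H⊑) (sorted-allFin N)
        good : ∀ X → X ⊆ ⟦ Z ⟧ → ∣ X ∣ ≡ k ∸ 1 → Good X ⟦ Z ⟧
        good = colour-zero⇒good sortedZ |Z| (hom Z⊑H |Z|)

open import Data.Integer as ℤ using (+_; -[1+_]; +<+)
import Data.Integer.Properties as ℤ
import Data.Sign as Sign
open import Data.Rational using (ℚ; mkℚ; 0ℚ; _/_; _*_) renaming (_<_ to _<ℚ_; _≤_ to _≤ℚ_)
open import Data.Rational.Properties using (normalize-coprime; toℚᵘ-mono-≤; toℚᵘ-homo-*; drop-*<*)
import Data.Rational.Unnormalised as ℚᵘ
import Data.Rational.Unnormalised.Properties as ℚᵘ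
open import Data.Nat.Coprimality using (1-coprimeTo) renaming (sym to coprime-sym)
open Realisation using (common-vertices)

-- A positive ρ = (p+1)/(d+1) is at least 1/(d+1).
density-bound : (ρ : ℚ) → 0ℚ <ℚ ρ →
  ∃[ D ] NonZero D × (∀ n s → ρ * ((+ n) / 1) ≤ℚ ((+ s) / 1) → n ≤ D ℕ.* s)
density-bound (mkℚ (+ zero) _ _) 0<ρ with drop-*<* 0<ρ
... | +<+ ()
density-bound (mkℚ -[1+ _ ] _ _) 0<ρ with drop-*<* 0<ρ
... | ()
density-bound ρ@(mkℚ (+ suc p) d _) _ = suc d , _ , bound
  where
  ⟨_⟩ : ℕ → ℚ
  ⟨ n ⟩ = mkℚ (+ n) 0 (coprime-sym (1-coprimeTo n))
  n/1≡⟨n⟩ : ∀ n → (+ n) / 1 ≡ ⟨ n ⟩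
  n/1≡⟨n⟩ n = normalize-coprime (coprime-sym (1-coprimeTo n))
  bound : ∀ n s → ρ * ((+ n) / 1) ≤ℚ ((+ s) / 1) → n ≤ suc d ℕ.* s
  bound n s ρn≤s
    with ℚᵘ.≤-respˡ-≃ (toℚᵘ-homo-* ρ ⟨ n ⟩) (toℚᵘ-mono-≤ (subst₂ _≤ℚ_ (cong (ρ *_) (n/1≡⟨n⟩ n)) (n/1≡⟨n⟩ s) ρn≤s))
  ... | ℚᵘ.*≤* [p+1]n≤s[d+1] = begin
    n                      ≤⟨ m≤m+n n (p ℕ.* n) ⟩
    n + p ℕ.* n            ≤⟨ ℤ.drop‿+≤+ (subst₂ ℤ._≤_ lhs rhs [p+1]n≤s[d+1]) ⟩
    s ℕ.* suc (d ℕ.* 1)    ≡⟨ cong (λ e → s ℕ.* suc e) (*-identityʳ d) ⟩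
    s ℕ.* suc d            ≡⟨ *-comm s (suc d) ⟩
    suc d ℕ.* s            ∎
    where
    open ≤-Reasoning
    lhs : (Sign.+ ℤ.◃ (n + p ℕ.* n)) ℤ.* + 1 ≡ + (n + p ℕ.* n)
    lhs = trans (ℤ.*-identityʳ _) (ℤ.+◃n≡+n _)
    rhs : + s ℤ.* + suc (d ℕ.* 1) ≡ + (s ℕ.* suc (d ℕ.* 1))
    rhs = sym (ℤ.pos-* s (suc (d ℕ.* 1)))

lemma5p5 : (ρ : ℚ) → 0ℚ <ℚ ρ → (m k t : ℕ) → 3 ≤ k → k ≤ m → 1 ≤ t → t ≤ k →
    Σ ℕ λ N → (G : ReducedGraph k N) →
      (S : (X : Subset N) → Fin N → Subset (ReducedGraph.size G X)) →
      ((X : Subset N) (y : Fin N) → ∣ X ∣ ≡ k ∸ 1 → y ∉ X → countBelow X y ≡ t ∸ 1 →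
        ρ * ((+ ReducedGraph.size G X) / 1) ≤ℚ ((+ ∣ S X y ∣) / 1)) →
      Σ (Subset N) λ M → ∣ M ∣ ≡ m ×
        Σ ((X : Subset N) → X ⊆ M → ∣ X ∣ ≡ k ∸ 1 → Fin (ReducedGraph.size G X)) λ v →
          (X : Subset N) (XM : X ⊆ M) (cX : ∣ X ∣ ≡ k ∸ 1) (y : Fin N) →
            y ∈ M → y ∉ X → countBelow X y ≡ t ∸ 1 → v X XM cX ∈ S X y
lemma5p5 ρ 0<ρ m k t _ _ _ t≤k =
  let D , D≢0 , ρ-bound = density-bound ρ 0<ρ
      N , common = common-vertices D {{D≢0}} m k t t≤k
  in N , λ G S ρ-dense → common G S λ X y ∣X∣ y∉X count → ρ-bound _ _ (ρ-dense X y ∣X∣ y∉X count)
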